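{- For positive integers $m\le n$ and $r$, we have $\chi_{r=}^*(K_m\times K_n)\le \min\big\{n-r\big\lfloor\frac{n}{m+r}\big\rfloor,\ m\big\lceil\frac{n}{m+r}\big\rceil\big\}$.
   Context: All graphs are finite, simple, undirected. For a positive integer $k$, a (proper) $k$-coloring of a graph $G$ is a map $f:V(G)\to\{1,\dots,k\}$ with $f(x)\ne f(y)$ whenever $xy\in E(G)$; its color classes are the sets $f^{ -1}(i)$, $i=1,\dots,k$. For a positive integer $r$, an $r$-equitable $k$-coloring is a $k$-coloring in which any two color classes differ in size by at most $r$; $G$ is $r$-equitably $k$-colorable if it has one. The $r$-equitable chromatic threshold $\chi_{r=}^*(G)$ is the smallest integer $k$ such that $G$ is $r$-equitably $k'$-colorable for every $k'\ge k$. The Kronecker product $G\times H$ has vertex set $V(G)\times V(H)$, with $(x,y)(x',y')$ an edge iff $xx'\in E(G)$ and $yy'\in E(H)$. $K_m$ is the complete graph on $m$ vertices. -}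

module Defs where

open import Data.Nat using (ℕ; zero; suc; _+_; _*_; _∸_; _≤_; _/_; NonZero)
open import Data.Fin using (Fin; remQuot)
open import Data.Fin.Properties using (_≟_)
open import Data.List using (length; filter)
open import Data.Fin.Base using () renaming (toℕ to toℕ)
open import Data.List.Base using (List)
open import Data.Vec.Functional using ()
open import Data.Product using (_×_; proj₁; proj₂)
open import Relation.Nullary using (¬_)
open import Relation.Binary.PropositionalEquality using (_≡_)
open import Level using (0ℓ)

record Graph : Set₁ where
  field
    order : ℕ
    Adj   : Fin order → Fin order → Set
    sym   : ∀ {x y} → Adj x y → Adj y x
    irrefl : ∀ {x} → ¬ Adj x x
open Graph public

K : ℕ → Graph
K m = record
  { order = m
  ; Adj = λ x y → ¬ (x ≡ y)
  ; sym = λ p q → p (Relation.Binary.PropositionalEquality.sym q)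
  ; irrefl = λ p → p Relation.Binary.PropositionalEquality.refl }
  where import Relation.Binary.PropositionalEquality

-- Kronecker (tensor) product; vertex set V(G) × V(H) encoded as
-- Fin (order G * order H) via the bijection remQuot.
_×ₖ_ : Graph → Graph → Graph
G ×ₖ H = record
  { order = order G * order H
  ; Adj = λ u v → Adj G (proj₁ (rq u)) (proj₁ (rq v)) × Adj H (proj₂ (rq u)) (proj₂ (rq v))
  ; sym = λ p → sym G (proj₁ p) Data.Product., sym H (proj₂ p)
  ; irrefl = λ p → irrefl G (proj₁ p) }
  where
    import Data.Product
    rq : Fin (order G * order H) → Fin (order G) × Fin (order H)
    rq = remQuot (order H)

IsColoring : (G : Graph) (k : ℕ) → (Fin (order G) → Fin k) → Set
IsColoring G k f = ∀ x y → Adj G x y → ¬ (f x ≡ f y)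

classSize : (G : Graph) {k : ℕ} → (Fin (order G) → Fin k) → Fin k → ℕ
classSize G f i = length (filter (λ v → f v ≟ i) (Data.List.allFin (order G)))
  where import Data.List

IsREquitable : (G : Graph) (r k : ℕ) → (Fin (order G) → Fin k) → Set
IsREquitable G r k f = ∀ i j → classSize G f i ≤ classSize G f j + r

REquitablyColorable : (G : Graph) (r k : ℕ) → Set
REquitablyColorable G r k =
  Data.Product.Σ (Fin (order G) → Fin k) λ f → IsColoring G k f × IsREquitable G r k f
  where import Data.Product

-- χ*_{r=}(G) ≤ b  ⇔  G is r-equitably k-colourable for every (positive) k ≥ b.
-- (χ*_{r=}(G) is the least b with this property.)
ThresholdAtMost : (G : Graph) (r b : ℕ) → Set
ThresholdAtMost G r b = ∀ k → 1 ≤ k → b ≤ k → REquitablyColorable G r k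

⌈_/_⌉ : ℕ → (d : ℕ) → .{{NonZero d}} → ℕ
⌈ a / d ⌉ = (a + d ∸ 1) / d

-- Write k = m u + j with u ≥ 1 and j < m, and put M = m u. Run through the cells of
-- K_m × K_n column by column and give the ℓ-th cell colour ℓ mod M: since m ∣ M, each
-- such class lies in a single row, hence is independent, and the class sizes differ by
-- at most one. To use the remaining j colours, each of the last j columns gives b of its
-- cells a colour of their own and lets only the other m − b take part in the enumeration;
-- with R = n m − j b enumerated cells, every row colour then has between ⌊R/M⌋ and ⌈R/M⌉
-- cells. For k ≥ n take b ∈ {⌊nm/k⌋, ⌊nm/k⌋ + 1}. For k < n take b = m: the assumed lower
-- bound on k gives n − j ≤ u (m + r), so that every row colour has between m and m + r cells.
module Submission where

open import Defs hiding (sym)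
open import Data.Nat using (ℕ; zero; suc; _+_; _*_; _∸_; _≤_; _<_; _⊓_; z≤n; s≤s; s≤s⁻¹; z<s; NonZero; >-nonZero; >-nonZero⁻¹; _/_; _%_; _≟_; _<?_; _≤?_)
open import Data.Nat.Properties
open import Data.Nat.DivMod
open import Data.Nat.Divisibility using (m∣m*n; n∣m*n)
open import Data.Nat.Solver using (module +-*-Solver)
open import Data.Fin as Fin using (Fin; toℕ; fromℕ<; _↑ˡ_; _↑ʳ_; combine; remQuot)
open import Data.Fin.Properties using (toℕ<n; toℕ-fromℕ<; toℕ-injective; remQuot-combine) renaming (_≟_ to _≟ᶠ_)
open import Data.List using (length; filter; tabulate; allFin)
open import Data.Product using (_×_; _,_; proj₁; proj₂; ∃₂; ∃-syntax)
open import Data.Sum using (_⊎_; inj₁; inj₂; [_,_]′)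
open import Data.Bool using (if_then_else_)
open import Function using (_∘_; id)
open import Relation.Nullary using (¬_; Dec; does; yes; no; contradiction)
open import Relation.Nullary.Decidable using (dec-true; dec-false)
open import Relation.Binary.PropositionalEquality
open import Algebra.Properties.CommutativeSemigroup +-commutativeSemigroup using (interchange)

open +-*-Solver

[kn+m]%n≡m : ∀ k m n .{{_ : NonZero n}} → m < n → (k * n + m) % n ≡ m
[kn+m]%n≡m k m n m<n = trans (cong (_% n) (+-comm (k * n) m)) (trans ([m+kn]%n≡m%n m k n) (m<n⇒m%n≡m m<n))

[m+n%d]%d≡[m+n]%d : ∀ m n d .{{_ : NonZero d}} → (m + n % d) % d ≡ (m + n) % d
[m+n%d]%d≡[m+n]%d m n d = begin
  (m + n % d) % d            ≡⟨ %-distribˡ-+ m (n % d) d ⟩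
  (m % d + n % d % d) % d    ≡⟨ cong (λ z → (m % d + z) % d) (m%n%n≡m%n n d) ⟩
  (m % d + n % d) % d        ≡⟨ sym (%-distribˡ-+ m n d) ⟩
  (m + n) % d                ∎
  where open ≡-Reasoning

n≤⌈n/d⌉*d : ∀ n d .{{_ : NonZero d}} → n ≤ ⌈ n / d ⌉ * d
n≤⌈n/d⌉*d n d@(suc d') = +-cancelˡ-≤ d' n _ (begin
  d' + n                           ≡⟨ +-comm d' n ⟩
  n + d'                           ≡⟨ m≡m%n+[m/n]*n (n + d') d ⟩
  (n + d') % d + (n + d') / d * d   ≤⟨ +-monoˡ-≤ _ (s≤s⁻¹ (m%n<n (n + d') d)) ⟩
  d' + (n + d') / d * d             ≡⟨ cong (λ a → d' + a / d * d) (sym (cong (_∸ 1) (+-suc n d'))) ⟩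
  d' + ⌈ n / d ⌉ * d                ∎)
  where open ≤-Reasoning

divMod-split : ∀ m k .{{_ : NonZero m}} → m ≤ k → ∃₂ λ u j → j < m × k ≡ m * suc u + j
divMod-split m k m≤k with k / m in k/m≡ | m≥n⇒m/n>0 {k} {m} m≤k
... | suc u | _ = u , k % m , m%n<n k m , (begin
  k                   ≡⟨ m≡m%n+[m/n]*n k m ⟩
  k % m + k / m * m   ≡⟨ cong (λ z → k % m + z * m) k/m≡ ⟩
  k % m + suc u * m   ≡⟨ +-comm (k % m) _ ⟩
  suc u * m + k % m   ≡⟨ cong (_+ k % m) (*-comm (suc u) m) ⟩
  m * suc u + k % m   ∎)
  where open ≡-Reasoning

if-yes : ∀ {P X : Set} (p? : Dec P) {x y : X} → P → (if does p? then x else y) ≡ x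
if-yes p? {x} {y} p = cong (if_then x else y) (dec-true p? p)

if-no : ∀ {P X : Set} (p? : Dec P) {x y : X} → ¬ P → (if does p? then x else y) ≡ y
if-no p? {x} {y} ¬p = cong (if_then x else y) (dec-false p? ¬p)

δ : ℕ → ℕ → ℕ
δ a c = if does (a ≟ c) then 1 else 0

δ-refl : ∀ a → δ a a ≡ 1
δ-refl a = if-yes (a ≟ a) refl

δ-≢ : ∀ {a c} → a ≢ c → δ a c ≡ 0
δ-≢ {a} {c} = if-no (a ≟ c)

δ-+ : ∀ k a c → δ (k + a) (k + c) ≡ δ a c
δ-+ zero    a c = refl
δ-+ (suc k) a c = δ-+ k a c

∑ : ℕ → (ℕ → ℕ) → ℕ
∑ zero    f = 0
∑ (suc n) f = f 0 + ∑ n (f ∘ suc)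

syntax ∑ n (λ i → f) = ∑[ i < n ] f

∑-cong : ∀ n {f g : ℕ → ℕ} → (∀ i → i < n → f i ≡ g i) → ∑ n f ≡ ∑ n g
∑-cong zero    f≗g = refl
∑-cong (suc n) f≗g = cong₂ _+_ (f≗g 0 z<s) (∑-cong n (λ i i<n → f≗g (suc i) (s≤s i<n)))

∑-+ : ∀ a b f → ∑ (a + b) f ≡ ∑ a f + ∑[ i < b ] f (a + i)
∑-+ zero    b f = refl
∑-+ (suc a) b f = trans (cong (f 0 +_) (∑-+ a b (f ∘ suc))) (sym (+-assoc (f 0) _ _))

∑-distrib : ∀ n f g → ∑[ i < n ] (f i + g i) ≡ ∑ n f + ∑ n g
∑-distrib zero    f g = refl
∑-distrib (suc n) f g =
  trans (cong (f 0 + g 0 +_) (∑-distrib n (f ∘ suc) (g ∘ suc))) (interchange (f 0) (g 0) _ _)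

∑-*ˡ : ∀ n c f → ∑[ i < n ] (c * f i) ≡ c * ∑ n f
∑-*ˡ zero    c f = sym (*-zeroʳ c)
∑-*ˡ (suc n) c f = trans (cong (c * f 0 +_) (∑-*ˡ n c (f ∘ suc))) (sym (*-distribˡ-+ c (f 0) _))

∑-const : ∀ n c → ∑[ i < n ] c ≡ n * c
∑-const zero    c = refl
∑-const (suc n) c = cong (c +_) (∑-const n c)

∑-zero : ∀ n {f} → (∀ i → i < n → f i ≡ 0) → ∑ n f ≡ 0
∑-zero n f≗0 = trans (∑-cong n f≗0) (trans (∑-const n 0) (*-zeroʳ n))

∑-swap : ∀ a b (f : ℕ → ℕ → ℕ) → ∑[ x < a ] ∑[ y < b ] f x y ≡ ∑[ y < b ] ∑[ x < a ] f x y
∑-swap zero    b f = sym (∑-zero b (λ _ _ → refl))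
∑-swap (suc a) b f = trans (cong (∑ b (f 0) +_) (∑-swap a b (f ∘ suc))) (sym (∑-distrib b _ _))

∑-blocks : ∀ a b f → ∑ (a * b) f ≡ ∑[ y < a ] ∑[ x < b ] f (y * b + x)
∑-blocks zero    b f = refl
∑-blocks (suc a) b f = begin
  ∑ (b + a * b) f                                    ≡⟨ ∑-+ b (a * b) f ⟩
  ∑ b f + ∑[ i < a * b ] f (b + i)                   ≡⟨ cong (∑ b f +_) (∑-blocks a b (λ i → f (b + i))) ⟩
  ∑ b f + ∑[ y < a ] ∑[ x < b ] f (b + (y * b + x))  ≡⟨ cong (∑ b f +_) (∑-cong a (λ y _ → ∑-cong b (λ x _ →
                                                          cong f (sym (+-assoc b (y * b) x))))) ⟩
  ∑ b f + ∑[ y < a ] ∑[ x < b ] f (suc y * b + x)    ∎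
  where open ≡-Reasoning

∑-monoˡ-≤ : ∀ {a b} f → a ≤ b → ∑ a f ≤ ∑ b f
∑-monoˡ-≤ {a} {b} f a≤b = begin
  ∑ a f                               ≤⟨ m≤m+n (∑ a f) _ ⟩
  ∑ a f + ∑[ i < b ∸ a ] f (a + i)    ≡⟨ sym (∑-+ a (b ∸ a) f) ⟩
  ∑ (a + (b ∸ a)) f                   ≡⟨ cong (λ z → ∑ z f) (m+[n∸m]≡n a≤b) ⟩
  ∑ b f                               ∎
  where open ≤-Reasoning

∑-δ : ∀ {n c} → c < n → ∑[ i < n ] δ i c ≡ 1
∑-δ {suc n} {zero}  _         = cong suc (∑-zero n (λ _ _ → refl))
∑-δ {suc n} {suc c} (s≤s c<n) = ∑-δ c<n

∑-rotate : ∀ m .{{_ : NonZero m}} a g → a < m → ∑[ x < m ] g ((x + a) % m) ≡ ∑ m g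
∑-rotate m a g a<m = begin
  ∑[ x < m ] g ((x + a) % m)
    ≡⟨ cong (λ z → ∑[ x < z ] g ((x + a) % m)) (sym (m∸n+n≡m a≤m)) ⟩
  ∑[ x < m ∸ a + a ] g ((x + a) % m)
    ≡⟨ ∑-+ (m ∸ a) a _ ⟩
  ∑[ x < m ∸ a ] g ((x + a) % m) + ∑[ i < a ] g ((m ∸ a + i + a) % m)
    ≡⟨ cong₂ _+_ (∑-cong (m ∸ a) unwrapped) (∑-cong a wrapped) ⟩
  ∑[ x < m ∸ a ] g (a + x) + ∑ a g
    ≡⟨ +-comm _ (∑ a g) ⟩
  ∑ a g + ∑[ x < m ∸ a ] g (a + x)
    ≡⟨ sym (∑-+ a (m ∸ a) g) ⟩
  ∑ (a + (m ∸ a)) g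
    ≡⟨ cong (λ z → ∑ z g) (m+[n∸m]≡n a≤m) ⟩
  ∑ m g ∎
  where
  open ≡-Reasoning
  a≤m = <⇒≤ a<m
  unwrapped : ∀ x → x < m ∸ a → g ((x + a) % m) ≡ g (a + x)
  unwrapped x x<m∸a = cong g (trans (m<n⇒m%n≡m (subst (x + a <_) (m∸n+n≡m a≤m) (+-monoˡ-< a x<m∸a))) (+-comm x a))
  wrapped : ∀ i → i < a → g ((m ∸ a + i + a) % m) ≡ g i
  wrapped i i<a = cong g (begin
    (m ∸ a + i + a) % m    ≡⟨ cong (_% m) (solve 3 (λ p i a → p :+ i :+ a := i :+ (p :+ a)) refl (m ∸ a) i a) ⟩
    (i + (m ∸ a + a)) % m  ≡⟨ cong (λ z → (i + z) % m) (m∸n+n≡m a≤m) ⟩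
    (i + m) % m            ≡⟨ [m+n]%n≡m%n i m ⟩
    i % m                  ≡⟨ m<n⇒m%n≡m (<-trans i<a a<m) ⟩
    i                      ∎)

∑Fin : ∀ N → (Fin N → ℕ) → ℕ
∑Fin zero    f = 0
∑Fin (suc N) f = f Fin.zero + ∑Fin N (f ∘ Fin.suc)

∑Fin-cong : ∀ N {f g : Fin N → ℕ} → (∀ v → f v ≡ g v) → ∑Fin N f ≡ ∑Fin N g
∑Fin-cong zero    f≗g = refl
∑Fin-cong (suc N) f≗g = cong₂ _+_ (f≗g Fin.zero) (∑Fin-cong N (f≗g ∘ Fin.suc))

∑Fin-toℕ : ∀ N f → ∑Fin N (f ∘ toℕ) ≡ ∑ N f
∑Fin-toℕ zero    f = refl
∑Fin-toℕ (suc N) f = cong (f 0 +_) (∑Fin-toℕ N (f ∘ suc))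

∑Fin-+ : ∀ a b (f : Fin (a + b) → ℕ) → ∑Fin (a + b) f ≡ ∑Fin a (λ i → f (i ↑ˡ b)) + ∑Fin b (λ i → f (a ↑ʳ i))
∑Fin-+ zero    b f = refl
∑Fin-+ (suc a) b f = trans (cong (f Fin.zero +_) (∑Fin-+ a b (f ∘ Fin.suc))) (sym (+-assoc (f Fin.zero) _ _))

∑Fin-combine : ∀ m n (f : Fin (m * n) → ℕ) → ∑Fin (m * n) f ≡ ∑Fin m (λ x → ∑Fin n (λ y → f (combine x y)))
∑Fin-combine zero    n f = refl
∑Fin-combine (suc m) n f =
  trans (∑Fin-+ n (m * n) f) (cong (∑Fin n (λ y → f (y ↑ˡ (m * n))) +_) (∑Fin-combine m n (λ i → f (n ↑ʳ i))))

length-filter-≟ : ∀ {N k} (h : Fin N → Fin k) (i : Fin k) →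
  length (filter (λ v → h v ≟ᶠ i) (allFin N)) ≡ ∑Fin N (λ v → δ (toℕ (h v)) (toℕ i))
length-filter-≟ {N} h i = go N id
  where
  go : ∀ M (g : Fin M → Fin N) →
    length (filter (λ v → h v ≟ᶠ i) (tabulate g)) ≡ ∑Fin M (λ v → δ (toℕ (h (g v))) (toℕ i))
  go zero    g = refl
  go (suc M) g with h (g Fin.zero) ≟ᶠ i
  ... | yes hit  = trans (cong suc (go M (g ∘ Fin.suc)))
                         (cong (_+ rest) (sym (trans (cong (λ v → δ (toℕ v) (toℕ i)) hit) (δ-refl (toℕ i)))))
    where rest = ∑Fin M (λ v → δ (toℕ (h (g (Fin.suc v)))) (toℕ i))
  ... | no  miss = trans (go M (g ∘ Fin.suc)) (cong (_+ rest) (sym (δ-≢ (miss ∘ toℕ-injective))))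
    where rest = ∑Fin M (λ v → δ (toℕ (h (g (Fin.suc v)))) (toℕ i))

InWindow : ℕ → ℕ → ℕ → Set
InWindow w r s = w ≤ s × s ≤ w + r

InWindow-widen : ∀ {w r r' s} → r ≤ r' → InWindow w r s → InWindow w r' s
InWindow-widen r≤r' (w≤s , s≤w+r) = w≤s , ≤-trans s≤w+r (+-monoʳ-≤ _ r≤r')

InWindow⇒REquitable : ∀ G {r k w} (f : Fin (order G) → Fin k) →
  (∀ i → InWindow w r (classSize G f i)) → IsREquitable G r k f
InWindow⇒REquitable G {r} f win i j = ≤-trans (proj₂ (win i)) (+-monoˡ-≤ r (proj₁ (win j)))

module GridColouring {m n k : ℕ} (col : ℕ → ℕ → ℕ) (col<k : ∀ {x y} → x < m → y < n → col x y < k) where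

  cellColour : Fin m × Fin n → Fin k
  cellColour (x , y) = fromℕ< (col<k (toℕ<n x) (toℕ<n y))

  colouring : Fin (m * n) → Fin k
  colouring = cellColour ∘ remQuot {m} n

  toℕ-colouring : ∀ v → toℕ (colouring v) ≡ col (toℕ (proj₁ (remQuot {m} n v))) (toℕ (proj₂ (remQuot {m} n v)))
  toℕ-colouring v = toℕ-fromℕ< _

  colouring-proper : (∀ {x x' y y'} → x < m → x' < m → col x y ≡ col x' y' → x ≡ x' ⊎ y ≡ y') →
    IsColoring (K m ×ₖ K n) k colouring
  colouring-proper sameLine u v (x≢x' , y≢y') same
    with sameLine (toℕ<n (proj₁ (remQuot {m} n u))) (toℕ<n (proj₁ (remQuot {m} n v)))
                  (trans (sym (toℕ-colouring u)) (trans (cong toℕ same) (toℕ-colouring v)))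
  ... | inj₁ x≡x' = x≢x' (toℕ-injective x≡x')
  ... | inj₂ y≡y' = y≢y' (toℕ-injective y≡y')

  classSize-colouring : ∀ i → classSize (K m ×ₖ K n) colouring i ≡ ∑[ x < m ] ∑[ y < n ] δ (col x y) (toℕ i)
  classSize-colouring i = begin
    classSize (K m ×ₖ K n) colouring i
      ≡⟨ length-filter-≟ colouring i ⟩
    ∑Fin (m * n) (λ v → δ (toℕ (colouring v)) (toℕ i))
      ≡⟨ ∑Fin-combine m n _ ⟩
    ∑Fin m (λ x → ∑Fin n (λ y → δ (toℕ (colouring (combine x y))) (toℕ i)))
      ≡⟨ ∑Fin-cong m (λ x → ∑Fin-cong n (λ y → cong (λ c → δ (toℕ (cellColour c)) (toℕ i)) (remQuot-combine x y))) ⟩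
    ∑Fin m (λ x → ∑Fin n (λ y → δ (toℕ (cellColour (x , y))) (toℕ i)))
      ≡⟨ ∑Fin-cong m (λ x → ∑Fin-cong n (λ y → cong (λ c → δ c (toℕ i)) (toℕ-fromℕ< (col<k (toℕ<n x) (toℕ<n y))))) ⟩
    ∑Fin m (λ x → ∑Fin n (λ y → δ (col (toℕ x) (toℕ y)) (toℕ i)))
      ≡⟨ ∑Fin-cong m (λ x → ∑Fin-toℕ n _) ⟩
    ∑Fin m (λ x → ∑[ y < n ] δ (col (toℕ x) y) (toℕ i))
      ≡⟨ ∑Fin-toℕ m _ ⟩
    ∑[ x < m ] ∑[ y < n ] δ (col x y) (toℕ i) ∎
    where open ≡-Reasoning

residueCount : (M : ℕ) .{{_ : NonZero M}} → ℕ → ℕ → ℕ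
residueCount M R c = ∑[ ℓ < R ] δ (ℓ % M) c

residueCount-* : ∀ M .{{_ : NonZero M}} w {c} → c < M → residueCount M (M * w) c ≡ w
residueCount-* M w {c} c<M = begin
  ∑[ ℓ < M * w ] δ (ℓ % M) c
    ≡⟨ cong (λ z → ∑[ ℓ < z ] δ (ℓ % M) c) (*-comm M w) ⟩
  ∑[ ℓ < w * M ] δ (ℓ % M) c
    ≡⟨ ∑-blocks w M _ ⟩
  ∑[ y < w ] ∑[ x < M ] δ ((y * M + x) % M) c
    ≡⟨ ∑-cong w (λ y _ → ∑-cong M (λ x x<M → cong (λ z → δ z c) ([kn+m]%n≡m y x M x<M))) ⟩
  ∑[ y < w ] ∑[ x < M ] δ x c
    ≡⟨ ∑-cong w (λ _ _ → ∑-δ c<M) ⟩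
  ∑[ y < w ] 1
    ≡⟨ trans (∑-const w 1) (*-identityʳ w) ⟩
  w ∎
  where open ≡-Reasoning

residueCount-InWindow : ∀ M .{{_ : NonZero M}} {R w r c} → c < M → M * w ≤ R → R ≤ M * (w + r) →
  InWindow w r (residueCount M R c)
residueCount-InWindow M {R} {w} {r} {c} c<M lower upper =
  subst (_≤ residueCount M R c) (residueCount-* M w c<M) (∑-monoˡ-≤ _ lower) ,
  subst (residueCount M R c ≤_) (residueCount-* M (w + r) c<M) (∑-monoˡ-≤ _ upper)

module Construction (m u n j b : ℕ) {{_ : NonZero m}} {{_ : NonZero u}} (j≤n : j ≤ n) (b≤m : b ≤ m) where

  M A l R : ℕ
  M = m * u
  A = n ∸ j
  l = m ∸ b
  R = A * m + j * l

  instance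
    M-nonZero : NonZero M
    M-nonZero = m*n≢0 m u

  -- Cell (x , A + t) takes position A m + t l + shift x t of the enumeration, which is ≡ x (mod m).
  shift : ℕ → ℕ → ℕ
  shift x t = (x + t * b % m) % m

  special : ℕ → ℕ → ℕ
  special t i = if does (i <? l) then (A * m + (t * l + i)) % M else M + t

  colour : ℕ → ℕ → ℕ
  colour x y = if does (y <? A) then (y * m + x) % M else special (y ∸ A) (shift x (y ∸ A))

  colour-ordinary : ∀ x y → y < A → colour x y ≡ (y * m + x) % M
  colour-ordinary x y = if-yes (y <? A)

  colour-special : ∀ x y → ¬ y < A → colour x y ≡ special (y ∸ A) (shift x (y ∸ A))
  colour-special x y = if-no (y <? A)

  colour-special-column : ∀ x t → colour x (A + t) ≡ special t (shift x t)
  colour-special-column x t =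
    trans (colour-special x (A + t) (m+n≮m A t)) (cong (λ s → special s (shift x s)) (m+n∸m≡n A t))

  special-row : ∀ x t → x < m → (A * m + (t * l + shift x t)) % m ≡ x
  special-row x t x<m = begin
    (A * m + (t * l + shift x t)) % m  ≡⟨ %-remove-+ˡ (t * l + shift x t) (n∣m*n A) ⟩
    (t * l + (x + t * b % m) % m) % m  ≡⟨ [m+n%d]%d≡[m+n]%d (t * l) (x + t * b % m) m ⟩
    (t * l + (x + t * b % m)) % m      ≡⟨ cong (_% m) (sym (+-assoc (t * l) x _)) ⟩
    (t * l + x + t * b % m) % m        ≡⟨ [m+n%d]%d≡[m+n]%d (t * l + x) (t * b) m ⟩
    (t * l + x + t * b) % m            ≡⟨ cong (_% m) (solve 4 (λ t l b x → t :* l :+ x :+ t :* b := t :* (l :+ b) :+ x) refl t l b x) ⟩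
    (t * (l + b) + x) % m              ≡⟨ cong (λ z → (t * z + x) % m) (m∸n+n≡m b≤m) ⟩
    (t * m + x) % m                    ≡⟨ [kn+m]%n≡m t x m x<m ⟩
    x                                  ∎
    where open ≡-Reasoning

  data Line (x y : ℕ) : Set where
    row    : ∀ q → q % m ≡ x → colour x y ≡ q % M → Line x y
    column : ∀ t → y ≡ A + t → colour x y ≡ M + t → Line x y

  line : ∀ x y → x < m → Line x y
  line x y x<m with y <? A
  ... | yes y<A = row (y * m + x) ([kn+m]%n≡m y x m x<m) (colour-ordinary x y y<A)
  ... | no  y≮A with shift x (y ∸ A) <? l
  ...   | yes i<l = row _ (special-row x (y ∸ A) x<m) (trans (colour-special x y y≮A) (if-yes (_ <? l) i<l))
  ...   | no  i≮l = column (y ∸ A) (sym (m+[n∸m]≡n (≮⇒≥ y≮A))) (trans (colour-special x y y≮A) (if-no (_ <? l) i≮l))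

  colour-sameLine : ∀ {x x' y y'} → x < m → x' < m → colour x y ≡ colour x' y' → x ≡ x' ⊎ y ≡ y'
  colour-sameLine {x} {x'} {y} {y'} x<m x'<m same with line x y x<m | line x' y' x'<m
  ... | row q q≡x c≡q | row q' q'≡x' c'≡q' = inj₁ (begin
    x            ≡⟨ sym q≡x ⟩
    q % m        ≡⟨ sym (m∣n⇒o%n%m≡o%m m M q (m∣m*n u)) ⟩
    q % M % m    ≡⟨ cong (_% m) (trans (sym c≡q) (trans same c'≡q')) ⟩
    q' % M % m   ≡⟨ m∣n⇒o%n%m≡o%m m M q' (m∣m*n u) ⟩
    q' % m       ≡⟨ q'≡x' ⟩
    x'           ∎)
    where open ≡-Reasoning
  ... | row q _ c≡q | column t' _ c'≡M+t' =
    contradiction (m%n<n q M) (≤⇒≯ (subst (M ≤_) (trans (sym c'≡M+t') (trans (sym same) c≡q)) (m≤m+n M t')))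
  ... | column t _ c≡M+t | row q' _ c'≡q' =
    contradiction (m%n<n q' M) (≤⇒≯ (subst (M ≤_) (trans (sym c≡M+t) (trans same c'≡q')) (m≤m+n M t)))
  ... | column t y≡A+t c≡M+t | column t' y'≡A+t' c'≡M+t' =
    inj₂ (trans y≡A+t (trans (cong (A +_) (+-cancelˡ-≡ M t t' (trans (sym c≡M+t) (trans same c'≡M+t')))) (sym y'≡A+t')))

  colour< : ∀ {x y} → x < m → y < n → colour x y < M + j
  colour< {x} {y} x<m y<n with line x y x<m
  ... | row q _ c≡q = subst (_< M + j) (sym c≡q) (<-≤-trans (m%n<n q M) (m≤m+n M j))
  ... | column t y≡A+t c≡M+t = subst (_< M + j) (sym c≡M+t) (+-monoʳ-< M (+-cancelˡ-< A t j A+t<A+j))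
    where
    A+t<A+j : A + t < A + j
    A+t<A+j = subst₂ _<_ y≡A+t (sym (m∸n+n≡m j≤n)) y<n

  size : ℕ → ℕ
  size c = ∑[ x < m ] ∑[ y < n ] δ (colour x y) c

  ordinary-columns : ∀ c → ∑[ y < A ] ∑[ x < m ] δ (colour x y) c ≡ residueCount M (A * m) c
  ordinary-columns c = begin
    ∑[ y < A ] ∑[ x < m ] δ (colour x y) c
      ≡⟨ ∑-cong A (λ y y<A → ∑-cong m (λ x _ → cong (λ z → δ z c) (colour-ordinary x y y<A))) ⟩
    ∑[ y < A ] ∑[ x < m ] δ ((y * m + x) % M) c
      ≡⟨ sym (∑-blocks A m _) ⟩
    residueCount M (A * m) c ∎
    where open ≡-Reasoning

  special-column : ∀ c t →
    ∑[ x < m ] δ (colour x (A + t)) c ≡ ∑[ i < l ] δ ((A * m + (t * l + i)) % M) c + b * δ (M + t) c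
  special-column c t = begin
    ∑[ x < m ] δ (colour x (A + t)) c
      ≡⟨ ∑-cong m (λ x _ → cong (λ z → δ z c) (colour-special-column x t)) ⟩
    ∑[ x < m ] δ (special t ((x + t * b % m) % m)) c
      ≡⟨ ∑-rotate m (t * b % m) (λ i → δ (special t i) c) (m%n<n (t * b) m) ⟩
    ∑[ i < m ] δ (special t i) c
      ≡⟨ cong (λ z → ∑[ i < z ] δ (special t i) c) (sym (m∸n+n≡m b≤m)) ⟩
    ∑[ i < l + b ] δ (special t i) c
      ≡⟨ ∑-+ l b _ ⟩
    ∑[ i < l ] δ (special t i) c + ∑[ i < b ] δ (special t (l + i)) c
      ≡⟨ cong₂ _+_ (∑-cong l (λ i i<l → cong (λ z → δ z c) (if-yes (i <? l) i<l)))
                   (∑-cong b (λ i _ → cong (λ z → δ z c) (if-no (l + i <? l) (m+n≮m l i)))) ⟩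
    ∑[ i < l ] δ ((A * m + (t * l + i)) % M) c + ∑[ i < b ] δ (M + t) c
      ≡⟨ cong (∑[ i < l ] δ ((A * m + (t * l + i)) % M) c +_) (∑-const b _) ⟩
    ∑[ i < l ] δ ((A * m + (t * l + i)) % M) c + b * δ (M + t) c ∎
    where open ≡-Reasoning

  special-columns : ∀ c → ∑[ t < j ] ∑[ x < m ] δ (colour x (A + t)) c ≡
    ∑[ ℓ < j * l ] δ ((A * m + ℓ) % M) c + ∑[ t < j ] (b * δ (M + t) c)
  special-columns c = begin
    ∑[ t < j ] ∑[ x < m ] δ (colour x (A + t)) c
      ≡⟨ ∑-cong j (λ t _ → special-column c t) ⟩
    ∑[ t < j ] (∑[ i < l ] δ ((A * m + (t * l + i)) % M) c + b * δ (M + t) c)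
      ≡⟨ ∑-distrib j _ _ ⟩
    ∑[ t < j ] ∑[ i < l ] δ ((A * m + (t * l + i)) % M) c + ∑[ t < j ] (b * δ (M + t) c)
      ≡⟨ cong (_+ ∑[ t < j ] (b * δ (M + t) c)) (sym (∑-blocks j l _)) ⟩
    ∑[ ℓ < j * l ] δ ((A * m + ℓ) % M) c + ∑[ t < j ] (b * δ (M + t) c) ∎
    where open ≡-Reasoning

  size-formula : ∀ c → size c ≡ residueCount M R c + ∑[ t < j ] (b * δ (M + t) c)
  size-formula c = begin
    size c
      ≡⟨ ∑-swap m n _ ⟩
    ∑[ y < n ] ∑[ x < m ] δ (colour x y) c
      ≡⟨ cong (λ z → ∑[ y < z ] ∑[ x < m ] δ (colour x y) c) (sym (m∸n+n≡m j≤n)) ⟩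
    ∑[ y < A + j ] ∑[ x < m ] δ (colour x y) c
      ≡⟨ ∑-+ A j _ ⟩
    ∑[ y < A ] ∑[ x < m ] δ (colour x y) c + ∑[ t < j ] ∑[ x < m ] δ (colour x (A + t)) c
      ≡⟨ cong₂ _+_ (ordinary-columns c) (special-columns c) ⟩
    residueCount M (A * m) c + (∑[ ℓ < j * l ] δ ((A * m + ℓ) % M) c + ∑[ t < j ] (b * δ (M + t) c))
      ≡⟨ sym (+-assoc (residueCount M (A * m) c) _ _) ⟩
    residueCount M (A * m) c + ∑[ ℓ < j * l ] δ ((A * m + ℓ) % M) c + ∑[ t < j ] (b * δ (M + t) c)
      ≡⟨ cong (_+ ∑[ t < j ] (b * δ (M + t) c)) (sym (∑-+ (A * m) (j * l) _)) ⟩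
    residueCount M R c + ∑[ t < j ] (b * δ (M + t) c) ∎
    where open ≡-Reasoning

  size-row-colour : ∀ c → c < M → size c ≡ residueCount M R c
  size-row-colour c c<M = trans (size-formula c) (trans (cong (residueCount M R c +_) (∑-zero j no-hit)) (+-identityʳ _))
    where
    no-hit : ∀ t → t < j → b * δ (M + t) c ≡ 0
    no-hit t _ = trans (cong (b *_) (δ-≢ (λ M+t≡c → ≤⇒≯ (subst (M ≤_) M+t≡c (m≤m+n M t)) c<M))) (*-zeroʳ b)

  size-column-colour : ∀ t → t < j → size (M + t) ≡ b
  size-column-colour t t<j = begin
    size (M + t)
      ≡⟨ size-formula (M + t) ⟩
    residueCount M R (M + t) + ∑[ t' < j ] (b * δ (M + t') (M + t))
      ≡⟨ cong₂ _+_ (∑-zero R (λ ℓ _ → δ-≢ (ℓ%M≢M+t ℓ))) (∑-*ˡ j b _) ⟩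
    b * ∑[ t' < j ] δ (M + t') (M + t)
      ≡⟨ cong (b *_) (trans (∑-cong j (λ t' _ → δ-+ M t' t)) (∑-δ t<j)) ⟩
    b * 1
      ≡⟨ *-identityʳ b ⟩
    b ∎
    where
    open ≡-Reasoning
    ℓ%M≢M+t : ∀ ℓ → ℓ % M ≢ M + t
    ℓ%M≢M+t ℓ eq = ≤⇒≯ (subst (M ≤_) (sym eq) (m≤m+n M t)) (m%n<n ℓ M)

  R≡nm∸jb : R ≡ n * m ∸ j * b
  R≡nm∸jb = begin
    R                             ≡⟨ sym (m+n∸n≡m R (j * b)) ⟩
    A * m + j * l + j * b ∸ j * b ≡⟨ cong (_∸ j * b) R+jb≡nm ⟩
    n * m ∸ j * b                 ∎
    where
    open ≡-Reasoning
    R+jb≡nm : A * m + j * l + j * b ≡ n * m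
    R+jb≡nm = begin
      A * m + j * l + j * b       ≡⟨ +-assoc (A * m) _ _ ⟩
      A * m + (j * l + j * b)     ≡⟨ cong (A * m +_) (sym (*-distribˡ-+ j l b)) ⟩
      A * m + j * (l + b)         ≡⟨ cong (λ z → A * m + j * z) (m∸n+n≡m b≤m) ⟩
      A * m + j * m               ≡⟨ sym (*-distribʳ-+ m A j) ⟩
      (A + j) * m                 ≡⟨ cong (_* m) (m∸n+n≡m j≤n) ⟩
      n * m                       ∎

  equitable : ∀ {r w} → InWindow w r b → (∀ c → c < M → InWindow w r (residueCount M (n * m ∸ j * b) c)) →
    REquitablyColorable (K m ×ₖ K n) r (M + j)
  equitable {r} {w} b-in rows-in =
    colouring , colouring-proper colour-sameLine , InWindow⇒REquitable (K m ×ₖ K n) colouring classes-in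
    where
    open GridColouring colour colour<
    size-in : ∀ c → c < M + j → InWindow w r (size c)
    size-in c c<M+j with c <? M
    ... | yes c<M = subst (InWindow w r) (sym (trans (size-row-colour c c<M) (cong (λ z → residueCount M z c) R≡nm∸jb)))
                          (rows-in c c<M)
    ... | no  c≮M = subst (InWindow w r) (sym (trans (cong size (sym M+t≡c)) (size-column-colour (c ∸ M) t<j))) b-in
      where
      M+t≡c : M + (c ∸ M) ≡ c
      M+t≡c = m+[n∸m]≡n (≮⇒≥ c≮M)
      t<j : c ∸ M < j
      t<j = +-cancelˡ-< M (c ∸ M) j (subst (_< M + j) (sym M+t≡c) c<M+j)
    classes-in : ∀ i → InWindow w r (classSize (K m ×ₖ K n) colouring i)
    classes-in i = subst (InWindow w r) (sym (classSize-colouring i)) (size-in (toℕ i) (toℕ<n i))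

equitable-k<n : ∀ m u n j r {{_ : NonZero m}} {{_ : NonZero u}} →
  m * u + j < n → n ∸ j ≤ u * (m + r) → REquitablyColorable (K m ×ₖ K n) r (m * u + j)
equitable-k<n m u n j r k<n columns =
  Construction.equitable m u n j m j≤n ≤-refl (≤-refl , m≤m+n m r) rows-in
  where
  instance
    mu-nonZero : NonZero (m * u)
    mu-nonZero = m*n≢0 m u
  j≤n : j ≤ n
  j≤n = ≤-trans (m≤n+m j (m * u)) (<⇒≤ k<n)
  lower : m * u * m ≤ (n ∸ j) * m
  lower = *-monoˡ-≤ m (m+n≤o⇒m≤o∸n (m * u) (<⇒≤ k<n))
  upper : (n ∸ j) * m ≤ m * u * (m + r)
  upper = ≤-trans (*-monoˡ-≤ m columns) (≤-reflexive (solve 3 (λ m u r → u :* (m :+ r) :* m := m :* u :* (m :+ r)) refl m u r))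
  rows-in : ∀ c → c < m * u → InWindow m r (residueCount (m * u) (n * m ∸ j * m) c)
  rows-in c c<mu = subst (λ R → InWindow m r (residueCount (m * u) R c)) (*-distribʳ-∸ m n j)
                         (residueCount-InWindow (m * u) c<mu lower upper)

equitable-balanced : ∀ m u n j b r s e {{_ : NonZero m}} {{_ : NonZero u}} → 1 ≤ r → j ≤ n → b ≤ m →
  InWindow s 1 b → e ≤ m * u → n * m ≡ m * u * s + e + j * b → REquitablyColorable (K m ×ₖ K n) r (m * u + j)
equitable-balanced m u n j b r s e 1≤r j≤n b≤m b-in e≤mu nm≡ =
  Construction.equitable m u n j b j≤n b≤m (InWindow-widen 1≤r b-in) rows-in
  where
  instance
    mu-nonZero : NonZero (m * u)
    mu-nonZero = m*n≢0 m u
  R≡ : n * m ∸ j * b ≡ m * u * s + e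
  R≡ = trans (cong (_∸ j * b) nm≡) (m+n∸n≡m _ (j * b))
  upper : m * u * s + e ≤ m * u * (s + 1)
  upper = ≤-trans (+-monoʳ-≤ (m * u * s) e≤mu) (≤-reflexive (solve 2 (λ M s → M :* s :+ M := M :* (s :+ con 1)) refl (m * u) s))
  rows-in : ∀ c → c < m * u → InWindow s r (residueCount (m * u) (n * m ∸ j * b) c)
  rows-in c c<mu = InWindow-widen 1≤r (subst (λ R → InWindow s 1 (residueCount (m * u) R c)) (sym R≡)
                     (residueCount-InWindow (m * u) c<mu (m≤m+n _ e) upper))

equitable-n≤k : ∀ m u n j r {{_ : NonZero m}} {{_ : NonZero u}} → 1 ≤ r → j < m → m ≤ n → n ≤ m * u + j →
  REquitablyColorable (K m ×ₖ K n) r (m * u + j)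
equitable-n≤k m u n j r 1≤r j<m m≤n n≤k = balanced (e ≤? m * u)
  where
  k = m * u + j
  instance
    k-nonZero : NonZero k
    k-nonZero = >-nonZero (<-≤-trans (>-nonZero⁻¹ m) (≤-trans m≤n n≤k))
  s = n * m / k
  e = n * m % k
  nm≡ : n * m ≡ e + s * k
  nm≡ = m≡m%n+[m/n]*n (n * m) k
  j≤n : j ≤ n
  j≤n = ≤-trans (<⇒≤ j<m) m≤n
  balanced : Dec (e ≤ m * u) → REquitablyColorable (K m ×ₖ K n) r k
  balanced (yes e≤mu) = equitable-balanced m u n j s r s e 1≤r j≤n s≤m (≤-refl , m≤m+n s 1) e≤mu
    (trans nm≡ (solve 4 (λ e s M j → e :+ s :* (M :+ j) := M :* s :+ e :+ j :* s) refl e s (m * u) j))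
    where
    s≤m : s ≤ m
    s≤m = ≤-trans (/-monoˡ-≤ k (≤-trans (*-monoˡ-≤ m n≤k) (≤-reflexive (*-comm k m)))) (≤-reflexive (m*n/n≡m m k))
  balanced (no e≰mu) = equitable-balanced m u n j (suc s) r s (e ∸ j) 1≤r j≤n s<m
    (n≤1+n s , ≤-reflexive (+-comm 1 s)) (m≤n+o⇒m∸n≤o e j (subst (e ≤_) (+-comm (m * u) j) (<⇒≤ (m%n<n (n * m) k))))
    (trans nm≡ (trans (cong (_+ s * k) (sym (m∸n+n≡m j≤e)))
      (solve 4 (λ e' s M j → e' :+ j :+ s :* (M :+ j) := M :* s :+ e' :+ j :* (con 1 :+ s)) refl (e ∸ j) s (m * u) j)))
    where
    mu<e : m * u < e
    mu<e = ≰⇒> e≰mu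
    j≤e : j ≤ e
    j≤e = ≤-trans (<⇒≤ j<m) (≤-trans (m≤m*n m u) (<⇒≤ mu<e))
    s<m : s < m
    s<m = ≰⇒> λ m≤s → <-irrefl refl (begin-strict
      n * m     ≤⟨ *-monoˡ-≤ m n≤k ⟩
      k * m     ≤⟨ *-monoʳ-≤ k m≤s ⟩
      k * s     ≡⟨ *-comm k s ⟩
      s * k     <⟨ +-monoˡ-< (s * k) (≤-<-trans z≤n mu<e) ⟩
      e + s * k ≡⟨ sym nm≡ ⟩
      n * m     ∎)
      where open ≤-Reasoning

threshold⇒multiplier : ∀ m n r k .{{_ : NonZero (m + r)}} →
  (n ∸ r * (n / (m + r))) ⊓ (m * ⌈ n / (m + r) ⌉) ≤ k → ∃[ x ] m * x ≤ k × n ≤ k + r * x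
threshold⇒multiplier m n r k β≤k = [ floor , ceil ]′ (⊓-sel (n ∸ r * q) (m * c))
  where
  open ≤-Reasoning
  q = n / (m + r)
  c = ⌈ n / (m + r) ⌉
  floor : (n ∸ r * q) ⊓ (m * c) ≡ n ∸ r * q → ∃[ x ] m * x ≤ k × n ≤ k + r * x
  floor β≡ = q , ≤-trans mq≤n∸rq n∸rq≤k , (begin
    n                   ≤⟨ m≤n+m∸n n (r * q) ⟩
    r * q + (n ∸ r * q) ≤⟨ +-monoʳ-≤ (r * q) n∸rq≤k ⟩
    r * q + k           ≡⟨ +-comm (r * q) k ⟩
    k + r * q           ∎)
    where
    n∸rq≤k = subst (_≤ k) β≡ β≤k
    mq≤n∸rq : m * q ≤ n ∸ r * q
    mq≤n∸rq = m+n≤o⇒m≤o∸n (m * q) (subst (_≤ n) (trans (*-comm q (m + r)) (*-distribʳ-+ q m r)) (m/n*n≤m n (m + r)))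
  ceil : (n ∸ r * q) ⊓ (m * c) ≡ m * c → ∃[ x ] m * x ≤ k × n ≤ k + r * x
  ceil β≡ = c , mc≤k , (begin
    n                 ≤⟨ n≤⌈n/d⌉*d n (m + r) ⟩
    c * (m + r)       ≡⟨ solve 3 (λ c m r → c :* (m :+ r) := m :* c :+ r :* c) refl c m r ⟩
    m * c + r * c     ≤⟨ +-monoˡ-≤ (r * c) mc≤k ⟩
    k + r * c         ∎)
    where
    mc≤k = subst (_≤ k) β≡ β≤k

multiplier⇒m≤k : ∀ {m n r k} x → m * x ≤ k → n ≤ k + r * x → k < n → m ≤ k
multiplier⇒m≤k {r = r} {k} zero _ n≤k+r*0 k<n =
  contradiction (subst (_ ≤_) (trans (cong (k +_) (*-zeroʳ r)) (+-identityʳ k)) n≤k+r*0) (<⇒≱ k<n)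
multiplier⇒m≤k {m} (suc x) mx≤k _ _ = ≤-trans (m≤m*n m (suc x)) mx≤k

multiplier⇒columns : ∀ {m n r k u j} x → m * x ≤ k → n ≤ k + r * x → k ≡ m * u + j → j < m → n ∸ j ≤ u * (m + r)
multiplier⇒columns {m} {n} {r} {k} {u} {j} x mx≤k n≤k+rx k≡ j<m = m≤n+o⇒m∸n≤o n j (begin
  n                     ≤⟨ n≤k+rx ⟩
  k + r * x             ≤⟨ +-monoʳ-≤ k (*-monoʳ-≤ r x≤u) ⟩
  k + r * u             ≡⟨ cong (_+ r * u) k≡ ⟩
  m * u + j + r * u     ≡⟨ solve 4 (λ m u j r → m :* u :+ j :+ r :* u := j :+ u :* (m :+ r)) refl m u j r ⟩
  j + u * (m + r)       ∎)
  where
  open ≤-Reasoning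
  k<m*[1+u] : k < m * suc u
  k<m*[1+u] = subst₂ _<_ (sym k≡) (trans (+-comm (m * u) m) (sym (*-suc m u))) (+-monoʳ-< (m * u) j<m)
  x≤u : x ≤ u
  x≤u = s≤s⁻¹ (*-cancelˡ-< m x (suc u) (≤-<-trans mx≤k k<m*[1+u]))

lemma11 : (m n r : ℕ) → 1 ≤ m → m ≤ n → 1 ≤ r →
    ThresholdAtMost (K m ×ₖ K n) r
      ((n ∸ r * ((n / suc (m + r ∸ 1)))) ⊓ (m * ⌈ n / suc (m + r ∸ 1) ⌉))
lemma11 m@(suc _) n r _ m≤n 1≤r k _ β≤k with n ≤? k
... | yes n≤k
  with u , j , j<m , refl ← divMod-split m k (≤-trans m≤n n≤k)
  = equitable-n≤k m (suc u) n j r 1≤r j<m m≤n n≤k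
... | no n≰k
  with x , mx≤k , n≤k+rx ← threshold⇒multiplier m n r k β≤k
  with u , j , j<m , refl ← divMod-split m k (multiplier⇒m≤k {r = r} x mx≤k n≤k+rx (≰⇒> n≰k))
  = equitable-k<n m (suc u) n j r (≰⇒> n≰k) (multiplier⇒columns x mx≤k n≤k+rx refl j<m)
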